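{- Let $(T_r)_{r\in\mathbb{Z}}$ be the Tribonacci sequence. Then for every non-negative integer $k$: \[ 8\sum_{j=1}^k T_{2j-1}^2 = T_{2k}^2 + 6T_{2k-1}^2 - 2T_{2k-2}^2 - T_{2k-4}^2 + 2 . \]
   Context: The Tribonacci sequence $(T_r)_{r\in\mathbb{Z}}$ is defined by $T_0=0$, $T_1=1$, $T_2=1$ and $T_r=T_{r-1}+T_{r-2}+T_{r-3}$ for all integers $r$ (this determines $T_r$ for negative $r$ as well). An empty sum equals $0$. -}

module Defs where

open import Data.Nat using (ℕ; zero; suc)
open import Data.Integer using (ℤ; +_; -[1+_]; _+_; _-_; _*_)
open import Data.Product using (_×_; _,_; proj₁)

-- Forward triples: tribFwd n = (T n , T (n+1) , T (n+2)) for n : ℕ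
tribFwd : ℕ → ℤ × ℤ × ℤ
tribFwd zero = (+ 0 , + 1 , + 1)
tribFwd (suc n) with tribFwd n
... | (a , b , c) = (b , c , a + b + c)

-- Backward triples: tribBwd m = (T (-m) , T (-m+1) , T (-m+2)) for m : ℕ
-- using T (r-3) = T r - T (r-1) - T (r-2)
tribBwd : ℕ → ℤ × ℤ × ℤ
tribBwd zero = (+ 0 , + 1 , + 1)
tribBwd (suc m) with tribBwd m
... | (a , b , c) = (c - b - a , a , b)

T : ℤ → ℤ
T (+ n) = proj₁ (tribFwd n)
T -[1+ m ] = proj₁ (tribBwd (suc m))

sumFrom1 : ℕ → (ℕ → ℤ) → ℤ
sumFrom1 zero f = + 0
sumFrom1 (suc k) f = sumFrom1 k f + f (suc k)

-- Writing E n := T(n+4)² + 6 T(n+3)² − 2 T(n+2)² − T(n)² + 2, the right-hand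
-- side at k + 2 is E (2k), and E (n + 2) − E n = 8 T(n+5)² for every n: once
-- T(n+3), …, T(n+6) are expanded by the recurrence, this is a polynomial identity
-- in T n, T(n+1), T(n+2). Summing over even n telescopes; the cases k = 0, 1,
-- which involve negative indices, are checked by computation.
module Submission where

open import Defs
open import Data.Nat using (ℕ; zero; suc)
import Data.Nat as ℕ
import Data.Nat.Properties as ℕ
open import Data.Integer using (ℤ; +_; _+_; _-_; _*_; _⊖_)
open import Data.Integer.Properties using (pos-*; m-n≡m⊖n; ⊖-≥; *-distribˡ-+)
open import Data.Integer.Tactic.RingSolver using (solve-∀)
open import Relation.Binary.PropositionalEquality
open ≡-Reasoning

+2*k≡ : ∀ k {m} → 2 ℕ.* k ≡ m → + 2 * + k ≡ + m
+2*k≡ k eq = trans (sym (pos-* 2 k)) (cong +_ eq)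

+2*k-c≡ : ∀ k c {m} → 2 ℕ.* k ≡ c ℕ.+ m → + 2 * + k - + c ≡ + m
+2*k-c≡ k c {m} eq = begin
  + 2 * + k - + c        ≡⟨ cong (_- + c) (+2*k≡ k eq) ⟩
  + (c ℕ.+ m) - + c      ≡⟨ m-n≡m⊖n (c ℕ.+ m) c ⟩
  (c ℕ.+ m) ⊖ c          ≡⟨ ⊖-≥ (ℕ.m≤m+n c m) ⟩
  + (c ℕ.+ m ℕ.∸ c)      ≡⟨ cong +_ (ℕ.m+n∸m≡n c m) ⟩
  + m                    ∎

energyAt : ℤ → ℤ → ℤ → ℤ → ℤ
energyAt a b c d = T a * T a + + 6 * (T b * T b) - + 2 * (T c * T c) - T d * T d + + 2

energyAt-cong : ∀ {a a′ b b′ c c′ d d′} → a ≡ a′ → b ≡ b′ → c ≡ c′ → d ≡ d′ →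
  energyAt a b c d ≡ energyAt a′ b′ c′ d′
energyAt-cong refl refl refl refl = refl

tribEnergy : ℕ → ℤ
tribEnergy n = energyAt (+ (4 ℕ.+ n)) (+ (3 ℕ.+ n)) (+ (2 ℕ.+ n)) (+ n)

energy-shift : ∀ x y z →
  let w = x + y + z ; v = y + z + w ; u = z + w + v ; t = w + v + u in
  t * t + + 6 * (u * u) - + 2 * (v * v) - z * z + + 2
    ≡ (v * v + + 6 * (w * w) - + 2 * (z * z) - x * x + + 2) + + 8 * (u * u)
energy-shift = solve-∀

tribEnergy-step : ∀ n →
  tribEnergy (2 ℕ.+ n) ≡ tribEnergy n + + 8 * (T (+ (5 ℕ.+ n)) * T (+ (5 ℕ.+ n)))
tribEnergy-step n = energy-shift (T (+ n)) (T (+ (1 ℕ.+ n))) (T (+ (2 ℕ.+ n)))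

oddSquare : ℕ → ℤ
oddSquare j = T (+ 2 * + j - + 1) * T (+ 2 * + j - + 1)

sum-oddSquare : ∀ n → + 8 * sumFrom1 (2 ℕ.+ n) oddSquare ≡ tribEnergy (2 ℕ.* n)
sum-oddSquare zero    = refl
sum-oddSquare (suc n) = begin
  + 8 * (sumFrom1 (2 ℕ.+ n) oddSquare + oddSquare (3 ℕ.+ n))
    ≡⟨ *-distribˡ-+ (+ 8) (sumFrom1 (2 ℕ.+ n) oddSquare) (oddSquare (3 ℕ.+ n)) ⟩
  + 8 * sumFrom1 (2 ℕ.+ n) oddSquare + + 8 * oddSquare (3 ℕ.+ n)
    ≡⟨ cong₂ _+_ (sum-oddSquare n) (cong (λ i → + 8 * (T i * T i)) (+2*k-c≡ (3 ℕ.+ n) 1 (ℕ.*-distribˡ-+ 2 3 n))) ⟩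
  tribEnergy (2 ℕ.* n) + + 8 * (T (+ (5 ℕ.+ 2 ℕ.* n)) * T (+ (5 ℕ.+ 2 ℕ.* n)))
    ≡⟨ sym (tribEnergy-step (2 ℕ.* n)) ⟩
  tribEnergy (2 ℕ.+ 2 ℕ.* n)
    ≡⟨ cong tribEnergy (sym (ℕ.*-distribˡ-+ 2 1 n)) ⟩
  tribEnergy (2 ℕ.* suc n) ∎

mainTheorem6 : (k : ℕ) →
    + 8 * sumFrom1 k (λ j → T (+ 2 * + j - + 1) * T (+ 2 * + j - + 1))
      ≡ T (+ 2 * + k) * T (+ 2 * + k)
        + + 6 * (T (+ 2 * + k - + 1) * T (+ 2 * + k - + 1))
        - + 2 * (T (+ 2 * + k - + 2) * T (+ 2 * + k - + 2))
        - T (+ 2 * + k - + 4) * T (+ 2 * + k - + 4)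
        + + 2
mainTheorem6 zero          = refl
mainTheorem6 (suc zero)    = refl
mainTheorem6 (suc (suc n)) = begin
  + 8 * sumFrom1 (2 ℕ.+ n) oddSquare  ≡⟨ sum-oddSquare n ⟩
  tribEnergy (2 ℕ.* n)                ≡⟨ sym (energyAt-cong (+2*k≡ k 2k) (+2*k-c≡ k 1 2k) (+2*k-c≡ k 2 2k) (+2*k-c≡ k 4 2k)) ⟩
  energyAt (+ 2 * + k) (+ 2 * + k - + 1) (+ 2 * + k - + 2) (+ 2 * + k - + 4) ∎
  where
  k : ℕ
  k = 2 ℕ.+ n
  2k : 2 ℕ.* k ≡ 4 ℕ.+ 2 ℕ.* n
  2k = ℕ.*-distribˡ-+ 2 2 n
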